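{- Let $(S,\mathcal{R})$ be an instance of the minimum axiom set problem and $k$ a non-negative integer. Let $\widehat S=\{\widehat s: s\in S\}$ be a disjoint copy of $S$, for $T\subseteq S$ let $\widehat T=\{\widehat t: t\in T\}$, and let $\widehat{\mathcal{R}}=\{(\widehat T,\widehat t): (T,t)\in\mathcal{R}\}$. Then $(S,\mathcal{R})$ admits an axiom set of size $k$ if and only if $(S\cup\widehat S,\mathcal{R}\cup\widehat{\mathcal{R}})$ admits an axiom set of size $2k$.
   Context: An instance of the minimum axiom set problem is a finite set $S$ (of sentences) together with a finite set $\mathcal{R}$ of relations, i.e. pairs $(T,t)$ with $T\subseteq S$ and $t\in S$. For $S_0\subseteq S$, define inductively $S_i$ as the union of $S_{i-1}$ and all $t\in S$ for which there is $T\subseteq S_{i-1}$ with $(T,t)\in\mathcal{R}$; the consequences of $S_0$ are $c(S_0)=\bigcup_{i\ge 1}S_i$. A set $A\subseteq S$ is an axiom set if $c(A)=S$. -}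

module Defs where

open import Data.Nat using (ℕ; zero; suc; _+_; _≥_)
open import Data.Fin using (Fin; _↑ˡ_; _↑ʳ_)
open import Data.Fin.Subset using (Subset; _∈_; ⊥; ∣_∣)
open import Data.Vec using (_++_)
open import Data.List using (List; map) renaming (_++_ to _++ₗ_)
import Data.List.Membership.Propositional as LM
open import Data.Product using (_×_; _,_; Σ; ∃; ∃-syntax)
open import Data.Sum using (_⊎_)
open import Relation.Binary.PropositionalEquality using (_≡_)

Relation : ℕ → Set
Relation n = Subset n × Fin n

Instance : ℕ → Set
Instance n = List (Relation n)

Stage : ∀ {n} → Instance n → Subset n → ℕ → Fin n → Set
Stage R S₀ zero s = s ∈ S₀
Stage R S₀ (suc i) s =
  Stage R S₀ i s
  ⊎ Σ (Relation _) (λ r → (r LM.∈ R) × ((Data.Product.proj₂ r ≡ s)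
       × (∀ x → x ∈ Data.Product.proj₁ r → Stage R S₀ i x)))

Consequence : ∀ {n} → Instance n → Subset n → Fin n → Set
Consequence R S₀ s = ∃[ i ] (i ≥ 1 × Stage R S₀ i s)

IsAxiomSet : ∀ {n} → Instance n → Subset n → Set
IsAxiomSet R A = ∀ s → Consequence R A s

HasAxiomSetOfSize : ∀ {n} → Instance n → ℕ → Set
HasAxiomSetOfSize {n} R k = ∃[ A ] (∣ A ∣ ≡ k × IsAxiomSet R A)

-- Doubling: S ∪ Ŝ is Fin (n + n); s ↦ s ↑ˡ n, ŝ ↦ n ↑ʳ s.
-- For T ⊆ S, T ⊆ S ∪ Ŝ is T ++ ⊥, and T̂ is ⊥ ++ T.
embed : ∀ {n} → Relation n → Relation (n + n)
embed {n} (T , t) = (T ++ ⊥ {n}) , t ↑ˡ n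

hat : ∀ {n} → Relation n → Relation (n + n)
hat {n} (T , t) = (⊥ {n} ++ T) , n ↑ʳ t

double : ∀ {n} → Instance n → Instance (n + n)
double R = map embed R ++ₗ map hat R

-- The two copies of (S, R) inside the doubled instance do not interact: a sentence of
-- either copy is derivable from an axiom set B₁ ∪ B̂₂ exactly when it is derivable in
-- (S, R) from the corresponding half.  So A ↦ A ∪ Â turns axiom sets of size k into
-- ones of size 2k; conversely, if ∣B₁∣ + ∣B₂∣ = 2k then one half has at most k and the
-- other at least k elements, whence k ≤ ∣S∣ and the smaller half, an axiom set of
-- (S, R), can be padded with further sentences to size exactly k.
module Submission where

open import Defs
open import Data.Nat using (ℕ; _*_)
open import Function.Bundles using (_⇔_)

open import Data.Nat using (zero; suc; _+_; _≤_; _≤?_; s≤s)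
open import Data.Nat.Properties
  using (≤-total; ≤-trans; ≤-antisym; ≰⇒>; n≤0⇒n≡0; +-identityʳ; +-monoˡ-≤; +-cancelˡ-≤)
open import Data.Fin using (Fin; _↑ˡ_; _↑ʳ_; splitAt)
open import Data.Fin.Properties using (↑ˡ-injective; ↑ʳ-injective; splitAt-↑ˡ; splitAt-↑ʳ)
open import Data.Fin.Subset using (Subset; _∈_; _⊆_; inside; outside; ∣_∣) renaming (⊥ to ∅)
open import Data.Fin.Subset.Properties using (∉⊥; ∣p∣≤n; ⊆-refl; s⊆s; out⊆)
open import Data.Vec using ([]; _∷_; _++_; here; there)
import Data.Vec as Vec
open import Data.List using (map)
import Data.List.Membership.Propositional.Properties as List
open import Data.Product using (_×_; _,_; ∃-syntax)
open import Data.Sum using (_⊎_; inj₁; inj₂)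
open import Data.Empty using (⊥-elim)
open import Function using (_∘_)
open import Function.Bundles using (mk⇔; Equivalence)
open import Relation.Binary.PropositionalEquality using (_≡_; _≢_; refl; sym; trans; cong; subst)
open import Relation.Nullary using (yes; no)

private
  variable
    n m : ℕ

↑-elim : (P : Fin (n + m) → Set) →
  (∀ s → P (s ↑ˡ m)) → (∀ t → P (n ↑ʳ t)) → ∀ x → P x
↑-elim {zero}  P f g x         = g x
↑-elim {suc n} P f g Fin.zero    = f Fin.zero
↑-elim {suc n} P f g (Fin.suc x) = ↑-elim (P ∘ Fin.suc) (f ∘ Fin.suc) g x

↑ʳ≢↑ˡ : (s t : Fin n) → n ↑ʳ t ≢ s ↑ˡ n
↑ʳ≢↑ˡ {n} s t eq with trans (sym (splitAt-↑ʳ n n t)) (trans (cong (splitAt n) eq) (splitAt-↑ˡ n s n))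
... | ()

∈-++⁺ˡ : {A : Subset n} {B : Subset m} {s : Fin n} → s ∈ A → s ↑ˡ m ∈ A ++ B
∈-++⁺ˡ here      = here
∈-++⁺ˡ (there p) = there (∈-++⁺ˡ p)

∈-++⁺ʳ : (A : Subset n) {B : Subset m} {t : Fin m} → t ∈ B → n ↑ʳ t ∈ A ++ B
∈-++⁺ʳ []      p = p
∈-++⁺ʳ (_ ∷ A) p = there (∈-++⁺ʳ A p)

∈-++⁻ˡ : (A : Subset n) {B : Subset m} (s : Fin n) → s ↑ˡ m ∈ A ++ B → s ∈ A
∈-++⁻ˡ (_ ∷ A) Fin.zero    here      = here
∈-++⁻ˡ (_ ∷ A) (Fin.suc s) (there p) = there (∈-++⁻ˡ A s p)

∈-++⁻ʳ : (A : Subset n) {B : Subset m} (t : Fin m) → n ↑ʳ t ∈ A ++ B → t ∈ B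
∈-++⁻ʳ []      t p         = p
∈-++⁻ʳ (_ ∷ A) t (there p) = ∈-++⁻ʳ A t p

∈-++-elim : {A : Subset n} {B : Subset m} (P : Fin (n + m) → Set) →
  (∀ {s} → s ∈ A → P (s ↑ˡ m)) → (∀ {t} → t ∈ B → P (n ↑ʳ t)) →
  ∀ {x} → x ∈ A ++ B → P x
∈-++-elim {A = []}    P f g p         = g p
∈-++-elim {A = _ ∷ A} P f g here      = f here
∈-++-elim {A = _ ∷ A} P f g (there p) = ∈-++-elim (P ∘ Fin.suc) (f ∘ there) g p

∣++∣ : (A : Subset n) (B : Subset m) → ∣ A ++ B ∣ ≡ ∣ A ∣ + ∣ B ∣
∣++∣ []             B = refl
∣++∣ (inside  ∷ A) B = cong suc (∣++∣ A B)
∣++∣ (outside ∷ A) B = ∣++∣ A B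

⊆-extend : (A : Subset n) {k : ℕ} → ∣ A ∣ ≤ k → k ≤ n → ∃[ B ] (A ⊆ B × ∣ B ∣ ≡ k)
⊆-extend A {zero} ∣A∣≤0 _ = A , ⊆-refl , n≤0⇒n≡0 ∣A∣≤0
⊆-extend (inside ∷ A) {suc k} (s≤s ∣A∣≤k) (s≤s k≤n) with ⊆-extend A ∣A∣≤k k≤n
... | B , A⊆B , ∣B∣≡k = inside ∷ B , s⊆s A⊆B , cong suc ∣B∣≡k
⊆-extend (outside ∷ A) {suc k} ∣A∣≤1+k (s≤s k≤n) with ∣ A ∣ ≤? k
... | yes ∣A∣≤k with ⊆-extend A ∣A∣≤k k≤n
...   | B , A⊆B , ∣B∣≡k = inside ∷ B , out⊆ A⊆B , cong suc ∣B∣≡k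
⊆-extend (outside ∷ A) {suc k} ∣A∣≤1+k (s≤s k≤n) | no ∣A∣≰k =
  outside ∷ A , ⊆-refl , ≤-antisym ∣A∣≤1+k (≰⇒> ∣A∣≰k)

n+n≡2*n : ∀ n → n + n ≡ 2 * n
n+n≡2*n n = cong (n +_) (sym (+-identityʳ n))

straddle : ∀ a b k → a + b ≡ k + k → (a ≤ k × k ≤ b) ⊎ (b ≤ k × k ≤ a)
straddle a b k a+b≡k+k with ≤-total a k
... | inj₁ a≤k = inj₁ (a≤k , +-cancelˡ-≤ k k b (subst (_≤ k + b) a+b≡k+k (+-monoˡ-≤ b a≤k)))
... | inj₂ k≤a = inj₂ (+-cancelˡ-≤ k b k (subst (k + b ≤_) a+b≡k+k (+-monoˡ-≤ b k≤a)) , k≤a)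

Consequence-map : {R : Instance n} {R′ : Instance m} {A : Subset n} {A′ : Subset m}
  {s : Fin n} {s′ : Fin m} →
  (∀ i → Stage R A i s → Stage R′ A′ i s′) → Consequence R A s → Consequence R′ A′ s′
Consequence-map f (i , i≥1 , st) = i , i≥1 , f i st

module _ {n : ℕ} (R : Instance n) where

  Stage-mono : {A A′ : Subset n} → A ⊆ A′ → ∀ i {s} → Stage R A i s → Stage R A′ i s
  Stage-mono A⊆A′ zero    s∈A = A⊆A′ s∈A
  Stage-mono A⊆A′ (suc i) (inj₁ st) = inj₁ (Stage-mono A⊆A′ i st)
  Stage-mono A⊆A′ (suc i) (inj₂ (r , r∈R , refl , prem)) =
    inj₂ (r , r∈R , refl , λ x x∈T → Stage-mono A⊆A′ i (prem x x∈T))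

  IsAxiomSet-mono : {A A′ : Subset n} → A ⊆ A′ → IsAxiomSet R A → IsAxiomSet R A′
  IsAxiomSet-mono A⊆A′ ax s = Consequence-map (λ i → Stage-mono A⊆A′ i) (ax s)

  HasAxiomSetOfSize-≤ : {A : Subset n} {k : ℕ} →
    IsAxiomSet R A → ∣ A ∣ ≤ k → k ≤ n → HasAxiomSetOfSize R k
  HasAxiomSetOfSize-≤ {A} ax ∣A∣≤k k≤n with ⊆-extend A ∣A∣≤k k≤n
  ... | B , A⊆B , ∣B∣≡k = B , ∣B∣≡k , IsAxiomSet-mono A⊆B ax

  module _ (B₁ B₂ : Subset n) where

    Stage-↑ˡ⁺ : ∀ i {s} → Stage R B₁ i s → Stage (double R) (B₁ ++ B₂) i (s ↑ˡ n)
    Stage-↑ˡ⁺ zero    s∈B₁ = ∈-++⁺ˡ s∈B₁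
    Stage-↑ˡ⁺ (suc i) (inj₁ st) = inj₁ (Stage-↑ˡ⁺ i st)
    Stage-↑ˡ⁺ (suc i) (inj₂ (r , r∈R , refl , prem)) =
      inj₂ (embed r , List.∈-++⁺ˡ (List.∈-map⁺ embed r∈R) , refl ,
            λ x → ∈-++-elim (Stage (double R) (B₁ ++ B₂) i)
                    (λ {s} s∈T → Stage-↑ˡ⁺ i (prem s s∈T)) (⊥-elim ∘ ∉⊥))

    Stage-↑ʳ⁺ : ∀ i {t} → Stage R B₂ i t → Stage (double R) (B₁ ++ B₂) i (n ↑ʳ t)
    Stage-↑ʳ⁺ zero    t∈B₂ = ∈-++⁺ʳ B₁ t∈B₂
    Stage-↑ʳ⁺ (suc i) (inj₁ st) = inj₁ (Stage-↑ʳ⁺ i st)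
    Stage-↑ʳ⁺ (suc i) (inj₂ (r , r∈R , refl , prem)) =
      inj₂ (hat r , List.∈-++⁺ʳ (map embed R) (List.∈-map⁺ hat r∈R) , refl ,
            λ x → ∈-++-elim (Stage (double R) (B₁ ++ B₂) i)
                    (⊥-elim ∘ ∉⊥) (λ {t} t∈T → Stage-↑ʳ⁺ i (prem t t∈T)))

    Stage-↑ˡ⁻ : ∀ i s → Stage (double R) (B₁ ++ B₂) i (s ↑ˡ n) → Stage R B₁ i s
    Stage-↑ˡ⁻ zero    s s∈B = ∈-++⁻ˡ B₁ s s∈B
    Stage-↑ˡ⁻ (suc i) s (inj₁ st) = inj₁ (Stage-↑ˡ⁻ i s st)
    Stage-↑ˡ⁻ (suc i) s (inj₂ (r , r∈R² , eq , prem)) with List.∈-++⁻ (map embed R) r∈R²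
    ... | inj₁ r∈R↑ with List.∈-map⁻ embed r∈R↑
    ...   | (T , t) , r∈R , refl =
      inj₂ ((T , t) , r∈R , ↑ˡ-injective n t s eq ,
            λ x x∈T → Stage-↑ˡ⁻ i x (prem (x ↑ˡ n) (∈-++⁺ˡ x∈T)))
    Stage-↑ˡ⁻ (suc i) s (inj₂ (r , r∈R² , eq , prem)) | inj₂ r∈R^ with List.∈-map⁻ hat r∈R^
    ...   | (T , t) , r∈R , refl = ⊥-elim (↑ʳ≢↑ˡ s t eq)

    Stage-↑ʳ⁻ : ∀ i t → Stage (double R) (B₁ ++ B₂) i (n ↑ʳ t) → Stage R B₂ i t
    Stage-↑ʳ⁻ zero    t t∈B = ∈-++⁻ʳ B₁ t t∈B
    Stage-↑ʳ⁻ (suc i) t (inj₁ st) = inj₁ (Stage-↑ʳ⁻ i t st)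
    Stage-↑ʳ⁻ (suc i) t (inj₂ (r , r∈R² , eq , prem)) with List.∈-++⁻ (map embed R) r∈R²
    ... | inj₁ r∈R↑ with List.∈-map⁻ embed r∈R↑
    ...   | (T , u) , r∈R , refl = ⊥-elim (↑ʳ≢↑ˡ u t (sym eq))
    Stage-↑ʳ⁻ (suc i) t (inj₂ (r , r∈R² , eq , prem)) | inj₂ r∈R^ with List.∈-map⁻ hat r∈R^
    ...   | (T , u) , r∈R , refl =
      inj₂ ((T , u) , r∈R , ↑ʳ-injective n u t eq ,
            λ x x∈T → Stage-↑ʳ⁻ i x (prem (n ↑ʳ x) (∈-++⁺ʳ ∅ x∈T)))

    IsAxiomSet-double : IsAxiomSet (double R) (B₁ ++ B₂) ⇔ (IsAxiomSet R B₁ × IsAxiomSet R B₂)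
    IsAxiomSet-double = mk⇔ split join
      where
      split : IsAxiomSet (double R) (B₁ ++ B₂) → IsAxiomSet R B₁ × IsAxiomSet R B₂
      split ax = (λ s → Consequence-map (λ i → Stage-↑ˡ⁻ i s) (ax (s ↑ˡ n)))
               , (λ t → Consequence-map (λ i → Stage-↑ʳ⁻ i t) (ax (n ↑ʳ t)))
      join : IsAxiomSet R B₁ × IsAxiomSet R B₂ → IsAxiomSet (double R) (B₁ ++ B₂)
      join (ax₁ , ax₂) = ↑-elim (Consequence (double R) (B₁ ++ B₂))
        (λ s → Consequence-map (λ i → Stage-↑ˡ⁺ i) (ax₁ s))
        (λ t → Consequence-map (λ i → Stage-↑ʳ⁺ i) (ax₂ t))

mainTheorem14 : ∀ {n} (R : Instance n) (k : ℕ) →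
    HasAxiomSetOfSize R k ⇔ HasAxiomSetOfSize (double R) (2 * k)
mainTheorem14 {n} R k = mk⇔ to from
  where
  to : HasAxiomSetOfSize R k → HasAxiomSetOfSize (double R) (2 * k)
  to (A , refl , ax) =
    A ++ A , trans (∣++∣ A A) (n+n≡2*n ∣ A ∣) , Equivalence.from (IsAxiomSet-double R A A) (ax , ax)

  from : HasAxiomSetOfSize (double R) (2 * k) → HasAxiomSetOfSize R k
  from (B , ∣B∣≡2k , ax) with Vec.splitAt n B
  ... | B₁ , B₂ , refl
    with Equivalence.to (IsAxiomSet-double R B₁ B₂) ax
       | straddle ∣ B₁ ∣ ∣ B₂ ∣ k (trans (sym (∣++∣ B₁ B₂)) (trans ∣B∣≡2k (sym (n+n≡2*n k))))
  ... | ax₁ , _ | inj₁ (∣B₁∣≤k , k≤∣B₂∣) = HasAxiomSetOfSize-≤ R ax₁ ∣B₁∣≤k (≤-trans k≤∣B₂∣ (∣p∣≤n B₂))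
  ... | _ , ax₂ | inj₂ (∣B₂∣≤k , k≤∣B₁∣) = HasAxiomSetOfSize-≤ R ax₂ ∣B₂∣≤k (≤-trans k≤∣B₁∣ (∣p∣≤n B₁))
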